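{- Let $R$ be a squarefree positive integer, let $c=R-\partial(R)$, and suppose $\gcd(R,c)=1$. Let $q$ be a prime not dividing $R$. Then \[cq-R=Rq-\partial(Rq)\quad\text{and}\quad \gcd(Rq,\,cq-R)=1.\]
   Context: $\partial$ denotes the arithmetic derivative: $\partial(p)=1$ for primes $p$, $\partial(ab)=a\partial(b)+b\partial(a)$; for squarefree $n$, $\partial(n)=\sum_{p\mid n}n/p$. -}

module Defs where

open import Data.Nat using (ℕ; zero; suc; _+_; _*_; _/_; _^_)
open import Data.Nat.Divisibility using (_∣_; _∣?_)
open import Data.Nat.Primality using (Prime; prime?)
open import Data.Nat.Properties using (_≟_)
open import Data.Nat.ListAction using (sum)
open import Data.List using (List; map; filter; upTo; length)
open import Relation.Nullary.Decidable using (_×-dec_; ¬?)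
open import Data.Product using (_×_)
open import Relation.Nullary using (¬_)

SquareFree : ℕ → Set
SquareFree n = ∀ p → Prime p → ¬ (p * p ∣ n)

-- p-adic valuation of n (for n ≥ 1): the number of k ∈ {1,…,n} with p^k ∣ n.
-- (For a prime p and n ≥ 1 one has v_p(n) ≤ n, so this counts exactly v_p(n).)
val : ℕ → ℕ → ℕ
val p n = length (filter (λ k → (p ^ suc k) ∣? n) (upTo n))

primeDivisors : ℕ → List ℕ
primeDivisors n = filter (λ p → prime? p ×-dec (p ∣? n)) (upTo (suc n))

div : ℕ → ℕ → ℕ
div n zero = zero
div n (suc p) = n / suc p

-- Arithmetic derivative on positive integers:
--   ∂(n) = Σ_{p prime, p ∣ n} v_p(n) · n / p,
-- which is the unique function with ∂(p) = 1 for primes and the Leibniz rule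
-- (∂(1) = 0). For squarefree n it reduces to Σ_{p ∣ n} n / p.
-- By convention ∂(0) = 0 here (the value at 0 is never used below).
∂ : ℕ → ℕ
∂ zero = zero
∂ n@(suc _) = sum (map (λ p → val p n * (div n p)) (primeDivisors n))

{-# OPTIONS --safe #-}

-- For squarefree n every valuation in the definition of ∂ is 1, so ∂ n = Σ_{p < N} s n p for
-- any N > n, where s n p is n / p if p is a prime divisor of n and 0 otherwise. For squarefree
-- R and a prime q ∤ R, Rq is squarefree, s (Rq) p = q · s R p for p ≠ q, and s (Rq) q = R
-- while s R q = 0; hence ∂(Rq) = q ∂R + R, which is the first claim after ring normalisation.
-- For the second, cq − R ≡ −R (mod q) and cq − R ≡ cq (mod R), and q ∤ R, gcd(R, c) = 1.
module Submission where

open import Defs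
open import Data.Nat using (ℕ; _*_; _≥_)
open import Data.Nat.Divisibility using (_∣_)
open import Data.Nat.Primality using (Prime)
open import Data.Integer using (ℤ; +_; _-_)
open import Data.Integer.GCD using (gcd)
open import Data.Product using (_×_)
open import Relation.Binary.PropositionalEquality using (_≡_)
open import Relation.Nullary using (¬_)

open import Function using (_∘_)
open import Level using (Level)
open import Data.Bool using (true; false; if_then_else_)
open import Data.Empty using (⊥-elim)
open import Data.Product using (_,_; proj₂)
open import Data.Sum using (inj₁; inj₂)
open import Data.List using (List; []; _∷_; map; filter; applyUpTo; upTo; length)
open import Data.List.Properties using (map-upTo; filter-accept; filter-none)
open import Data.List.Relation.Unary.All.Properties using (applyUpTo⁺₂)
open import Data.Nat.Base using (zero; suc; _+_; _≤_; _<_; z≤n; s≤s; _/_; _^_; NonZero; ≢-nonZero⁻¹)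
open import Data.Nat.Properties
  using ( suc-injective; +-comm; +-assoc; *-comm; *-assoc; *-zeroʳ; *-identityˡ; *-identityʳ
        ; *-distribˡ-+; m≤m*n; m≤n*m; ≤-refl; <-irrefl; <-≤-trans)
open import Data.Nat.Divisibility
  using (_∣?_; _∣0; ∣-trans; ∣⇒≤; m∣m*n; n∣m*n; ∣m⇒∣m*n; *-cancelʳ-∣)
open import Data.Nat.DivMod using (m*n/n≡m; *-/-assoc)
open import Data.Nat.Primality
  using (prime?; prime[2]; ¬prime[1]; prime⇒nonZero; prime⇒irreducible; euclidsLemma)
open import Data.Nat.ListAction using (sum)
open import Data.Nat.Coprimality as ℕ using (Coprime; coprime-divisor; gcd≡1⇒coprime; coprime⇒gcd≡1)
import Data.Integer as ℤ
open import Data.Integer.Properties as ℤ using (pos-*; pos-+; abs-*; ∣-i∣≡∣i∣; -1*i≡-i; +-injective)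
open import Data.Integer.Divisibility.Signed as ℤ∣ using (∣ᵤ⇒∣; ∣⇒∣ᵤ; ∣m+n∣n⇒∣m; ∣n⇒∣m*n)
import Data.Integer.Coprimality as ℤ
open import Data.Integer.Tactic.RingSolver using (solve-∀)
open import Relation.Nullary using (yes; no; does)
open import Relation.Nullary.Decidable using (_×-dec_)
open import Relation.Unary using (Pred; Decidable)
open import Relation.Binary.PropositionalEquality
  using (refl; sym; trans; cong; cong₂; subst; _≢_; _≗_; module ≡-Reasoning)

open ≡-Reasoning

private
  variable
    a ℓ : Level
    A : Set a
    f g : ℕ → ℕ
    j m n o p q N : ℕ

sum-map-filter : {P : Pred A ℓ} (P? : Decidable P) (h : A → ℕ) (xs : List A) →
                 sum (map h (filter P? xs)) ≡ sum (map (λ x → if does (P? x) then h x else 0) xs)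
sum-map-filter P? h []       = refl
sum-map-filter P? h (x ∷ xs) with does (P? x)
... | true  = cong (_+_ (h x)) (sum-map-filter P? h xs)
... | false = sum-map-filter P? h xs

sum-applyUpTo-cong : ∀ n → f ≗ g → sum (applyUpTo f n) ≡ sum (applyUpTo g n)
sum-applyUpTo-cong zero    f≗g = refl
sum-applyUpTo-cong (suc n) f≗g = cong₂ _+_ (f≗g 0) (sum-applyUpTo-cong n (f≗g ∘ suc))

sum-applyUpTo-* : ∀ m f n → sum (applyUpTo (λ i → m * f i) n) ≡ m * sum (applyUpTo f n)
sum-applyUpTo-* m f zero    = sym (*-zeroʳ m)
sum-applyUpTo-* m f (suc n) =
  trans (cong (_+_ (m * f 0)) (sum-applyUpTo-* m (f ∘ suc) n))
        (sym (*-distribˡ-+ m (f 0) (sum (applyUpTo (f ∘ suc) n))))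

sum-applyUpTo-tail : m ≤ N → (∀ i → m ≤ i → f i ≡ 0) → sum (applyUpTo f N) ≡ sum (applyUpTo f m)
sum-applyUpTo-tail {m = zero}  {N = zero}  _         _   = refl
sum-applyUpTo-tail {m = zero}  {N = suc N} _         f≡0 =
  cong₂ _+_ (f≡0 0 z≤n) (sum-applyUpTo-tail {N = N} z≤n (λ i _ → f≡0 (suc i) z≤n))
sum-applyUpTo-tail {m = suc m} {N = suc N} {f = f} (s≤s m≤N) f≡0 =
  cong (_+_ (f 0)) (sum-applyUpTo-tail m≤N (λ i m≤i → f≡0 (suc i) (s≤s m≤i)))

sum-applyUpTo-except : j < N → (∀ i → i ≢ j → f i ≡ g i) → g j ≡ 0 →
                       sum (applyUpTo f N) ≡ sum (applyUpTo g N) + f j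
sum-applyUpTo-except {j = zero} {N = suc N} {f = f} {g = g} _ f≡g g0≡0 = begin
  f 0 + sum (applyUpTo (f ∘ suc) N)       ≡⟨ +-comm (f 0) _ ⟩
  sum (applyUpTo (f ∘ suc) N) + f 0       ≡⟨ cong (_+ f 0) (sum-applyUpTo-cong N λ i → f≡g (suc i) λ ()) ⟩
  sum (applyUpTo (g ∘ suc) N) + f 0       ≡⟨ cong (λ x → x + sum (applyUpTo (g ∘ suc) N) + f 0) (sym g0≡0) ⟩
  g 0 + sum (applyUpTo (g ∘ suc) N) + f 0 ∎
sum-applyUpTo-except {j = suc j} {N = suc N} {f = f} {g = g} (s≤s j<N) f≡g gj≡0 = begin
  f 0 + sum (applyUpTo (f ∘ suc) N)               ≡⟨ cong₂ _+_ (f≡g 0 λ ()) tail-sum ⟩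
  g 0 + (sum (applyUpTo (g ∘ suc) N) + f (suc j)) ≡⟨ sym (+-assoc (g 0) _ _) ⟩
  g 0 + sum (applyUpTo (g ∘ suc) N) + f (suc j)   ∎
  where
  tail-sum : sum (applyUpTo (f ∘ suc) N) ≡ sum (applyUpTo (g ∘ suc) N) + f (suc j)
  tail-sum = sum-applyUpTo-except j<N (λ i i≢j → f≡g (suc i) (i≢j ∘ suc-injective)) gj≡0

prime∣prime⇒≡ : Prime p → Prime q → p ∣ q → p ≡ q
prime∣prime⇒≡ pp pq p∣q with prime⇒irreducible pq p∣q
... | inj₁ refl = ⊥-elim (¬prime[1] pp)
... | inj₂ p≡q  = p≡q

prime∤⇒coprime : Prime p → ¬ p ∣ n → Coprime p n
prime∤⇒coprime pp p∤n (d∣p , d∣n) with prime⇒irreducible pp d∣p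
... | inj₁ d≡1 = d≡1
... | inj₂ refl = ⊥-elim (p∤n d∣n)

coprime-*ˡ : Coprime m o → Coprime n o → Coprime (m * n) o
coprime-*ˡ {m = m} m⊥o n⊥o (d∣mn , d∣o) = n⊥o (coprime-divisor d⊥m d∣mn , d∣o)
  where
  d⊥m : Coprime _ m
  d⊥m (e∣d , e∣m) = m⊥o (e∣m , ∣-trans e∣d d∣o)

squarefree⇒nonZero : SquareFree n → NonZero n
squarefree⇒nonZero {n = zero}  sf = ⊥-elim (sf 2 prime[2] (4 ∣0))
squarefree⇒nonZero {n = suc n} _  = _

squarefree-*-prime : SquareFree m → Prime q → ¬ q ∣ m → SquareFree (m * q)
squarefree-*-prime {m = m} {q = q} sf pq q∤m p pp p²∣mq with p ∣? q
... | yes p∣q with refl ← prime∣prime⇒≡ pp pq p∣q = q∤m (*-cancelʳ-∣ q {{prime⇒nonZero pq}} p²∣mq)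
... | no  p∤q = sf p pp (coprime-divisor (coprime-*ˡ p⊥q p⊥q) p²∣qm)
  where
  p⊥q : Coprime p q
  p⊥q = prime∤⇒coprime pp p∤q
  p²∣qm : p * p ∣ q * m
  p²∣qm = subst (p * p ∣_) (*-comm m q) p²∣mq

val-squarefree : p ∣ n → ¬ p * p ∣ n → val p n ≡ 1
val-squarefree {p = p} {n = zero}  _   p²∤n = ⊥-elim (p²∤n ((p * p) ∣0))
val-squarefree {p = p} {n = suc m} p∣n p²∤n = begin
  length (filter P? (0 ∷ applyUpTo suc m))   ≡⟨ cong length (filter-accept P? p¹∣n) ⟩
  suc (length (filter P? (applyUpTo suc m))) ≡⟨ cong (suc ∘ length) (filter-none P? (applyUpTo⁺₂ suc m p^[2+i]∤n)) ⟩
  1                                          ∎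
  where
  P? : Decidable (λ k → p ^ suc k ∣ suc m)
  P? k = p ^ suc k ∣? suc m
  p¹∣n : p ^ 1 ∣ suc m
  p¹∣n = subst (_∣ suc m) (sym (*-identityʳ p)) p∣n
  p²∣p^[2+i] : ∀ i → p * p ∣ p ^ suc (suc i)
  p²∣p^[2+i] i = subst (p * p ∣_) (*-assoc p p (p ^ i)) (m∣m*n (p ^ i))
  p^[2+i]∤n : ∀ i → ¬ p ^ suc (suc i) ∣ suc m
  p^[2+i]∤n i = p²∤n ∘ ∣-trans (p²∣p^[2+i] i)

div-*-cancelʳ : ∀ m n .{{_ : NonZero n}} → div (m * n) n ≡ m
div-*-cancelʳ m (suc n) = m*n/n≡m m (suc n)

div-*ʳ : p ∣ m → div (m * n) p ≡ n * div m p
div-*ʳ {p = zero}  {n = n} _   = sym (*-zeroʳ n)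
div-*ʳ {p = suc p} {m} {n} p∣m = trans (cong (_/ suc p) (*-comm m n)) (*-/-assoc n p∣m)

∂-summand : ℕ → ℕ → ℕ
∂-summand n p = if does (prime? p ×-dec p ∣? n) then div n p else 0

∂-summand-prime-divisor : Prime p → p ∣ n → ∂-summand n p ≡ div n p
∂-summand-prime-divisor {p} {n} pp p∣n with prime? p | p ∣? n
... | yes _  | yes _   = refl
... | no ¬pp | _       = ⊥-elim (¬pp pp)
... | yes _  | no p∤n  = ⊥-elim (p∤n p∣n)

∂-summand-non-prime-divisor : ¬ (Prime p × p ∣ n) → ∂-summand n p ≡ 0
∂-summand-non-prime-divisor {p} {n} ¬[pp×p∣n] with prime? p | p ∣? n
... | yes pp | yes p∣n = ⊥-elim (¬[pp×p∣n] (pp , p∣n))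
... | yes _  | no _    = refl
... | no _   | _       = refl

∂-squarefree : SquareFree n → n < N → ∂ n ≡ sum (applyUpTo (∂-summand n) N)
∂-squarefree {n = zero}      sf _   = ⊥-elim (≢-nonZero⁻¹ 0 {{squarefree⇒nonZero sf}} refl)
∂-squarefree {n = n@(suc _)} {N} sf n<N = begin
  ∂ n                                       ≡⟨ sum-map-filter P? (λ p → val p n * div n p) (upTo (suc n)) ⟩
  sum (map weighted-summand (upTo (suc n))) ≡⟨ cong sum (map-upTo weighted-summand (suc n)) ⟩
  sum (applyUpTo weighted-summand (suc n))  ≡⟨ sum-applyUpTo-cong (suc n) weighted-summand≗∂-summand ⟩
  sum (applyUpTo (∂-summand n) (suc n))     ≡⟨ sym (sum-applyUpTo-tail n<N beyond-n) ⟩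
  sum (applyUpTo (∂-summand n) N)           ∎
  where
  P? : Decidable (λ p → Prime p × p ∣ n)
  P? p = prime? p ×-dec p ∣? n
  weighted-summand : ℕ → ℕ
  weighted-summand p = if does (P? p) then val p n * div n p else 0
  weighted-summand≗∂-summand : weighted-summand ≗ ∂-summand n
  weighted-summand≗∂-summand p with prime? p | p ∣? n
  ... | yes pp | yes p∣n = trans (cong (_* div n p) (val-squarefree p∣n (sf p pp))) (*-identityˡ (div n p))
  ... | yes _  | no _    = refl
  ... | no _   | _       = refl
  beyond-n : ∀ p → suc n ≤ p → ∂-summand n p ≡ 0
  beyond-n p n<p = ∂-summand-non-prime-divisor λ (_ , p∣n) → <-irrefl refl (<-≤-trans n<p (∣⇒≤ p∣n))

∂-summand-*-prime-≢ : Prime q → p ≢ q → ∂-summand (m * q) p ≡ q * ∂-summand m p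
∂-summand-*-prime-≢ {q} {p} {m} pq p≢q with prime? p ×-dec p ∣? m
... | yes (pp , p∣m) = begin
  ∂-summand (m * q) p ≡⟨ ∂-summand-prime-divisor pp (∣m⇒∣m*n q p∣m) ⟩
  div (m * q) p       ≡⟨ div-*ʳ p∣m ⟩
  q * div m p         ≡⟨ cong (q *_) (sym (∂-summand-prime-divisor pp p∣m)) ⟩
  q * ∂-summand m p   ∎
... | no ¬[pp×p∣m] = begin
  ∂-summand (m * q) p ≡⟨ ∂-summand-non-prime-divisor ¬[pp×p∣mq] ⟩
  0                   ≡⟨ sym (*-zeroʳ q) ⟩
  q * 0               ≡⟨ cong (q *_) (sym (∂-summand-non-prime-divisor ¬[pp×p∣m])) ⟩
  q * ∂-summand m p   ∎
  where
  ¬[pp×p∣mq] : ¬ (Prime p × p ∣ m * q)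
  ¬[pp×p∣mq] (pp , p∣mq) with euclidsLemma m q pp p∣mq
  ... | inj₁ p∣m = ¬[pp×p∣m] (pp , p∣m)
  ... | inj₂ p∣q = p≢q (prime∣prime⇒≡ pp pq p∣q)

∂-summand-*-prime-self : Prime q → ∂-summand (m * q) q ≡ m
∂-summand-*-prime-self {q} {m} pq =
  trans (∂-summand-prime-divisor pq (n∣m*n m)) (div-*-cancelʳ m q {{prime⇒nonZero pq}})

∂-*-prime : SquareFree m → Prime q → ¬ q ∣ m → ∂ (m * q) ≡ q * ∂ m + m
∂-*-prime {m} {q} sf pq q∤m = begin
  ∂ (m * q)                                       ≡⟨ ∂-squarefree sf[mq] (s≤s ≤-refl) ⟩
  sum (applyUpTo (∂-summand (m * q)) bound)       ≡⟨ split-off-q ⟩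
  sum (applyUpTo (λ p → q * ∂-summand m p) bound)
    + ∂-summand (m * q) q                         ≡⟨ cong₂ _+_ (sum-applyUpTo-* q (∂-summand m) bound)
                                                               (∂-summand-*-prime-self pq) ⟩
  q * sum (applyUpTo (∂-summand m) bound) + m     ≡⟨ cong (λ s → q * s + m) (sym (∂-squarefree sf m<bound)) ⟩
  q * ∂ m + m                                     ∎
  where
  instance
    _ = squarefree⇒nonZero sf
    _ = prime⇒nonZero pq
  bound = suc (m * q)
  q<bound : q < bound
  q<bound = s≤s (m≤n*m q m)
  m<bound : m < bound
  m<bound = s≤s (m≤m*n m q)
  sf[mq] : SquareFree (m * q)
  sf[mq] = squarefree-*-prime sf pq q∤m
  q-summand≡0 : q * ∂-summand m q ≡ 0
  q-summand≡0 = trans (cong (q *_) (∂-summand-non-prime-divisor (q∤m ∘ proj₂))) (*-zeroʳ q)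
  split-off-q : sum (applyUpTo (∂-summand (m * q)) bound)
              ≡ sum (applyUpTo (λ p → q * ∂-summand m p) bound) + ∂-summand (m * q) q
  split-off-q = sum-applyUpTo-except q<bound (λ p → ∂-summand-*-prime-≢ pq) q-summand≡0

coprime-+-*ʳ : ∀ i j k → ℤ.Coprime i j → ℤ.Coprime i (j ℤ.+ k ℤ.* i)
coprime-+-*ʳ i j k i⊥j {d} (d∣i , d∣j+ki) = i⊥j (d∣i , ∣⇒∣ᵤ {i = j} d∣j)
  where
  d∣j : + d ℤ∣.∣ j
  d∣j = ∣m+n∣n⇒∣m {+ d} {j} {k ℤ.* i} (∣ᵤ⇒∣ d∣j+ki) (∣n⇒∣m*n k (∣ᵤ⇒∣ {i = i} d∣i))

coprime[mq,cq-m] : ∀ c → ℤ.Coprime (+ m) c → Prime q → ¬ q ∣ m →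
                   ℤ.Coprime (+ (m * q)) (c ℤ.* + q - + m)
coprime[mq,cq-m] {m} {q} c m⊥c pq q∤m = coprime-*ˡ m⊥cq-m q⊥cq-m
  where
  q⊥m : Coprime q m
  q⊥m = prime∤⇒coprime pq q∤m
  m⊥cq : ℤ.Coprime (+ m) (c ℤ.* + q)
  m⊥cq = subst (Coprime m) (sym (abs-* c (+ q))) (ℕ.sym (coprime-*ˡ (ℕ.sym m⊥c) q⊥m))
  m⊥cq-m : ℤ.Coprime (+ m) (c ℤ.* + q - + m)
  m⊥cq-m = subst (ℤ.Coprime (+ m)) (cong (ℤ._+_ (c ℤ.* + q)) (-1*i≡-i (+ m)))
                 (coprime-+-*ʳ (+ m) (c ℤ.* + q) ℤ.-1ℤ m⊥cq)
  q⊥-m : ℤ.Coprime (+ q) (ℤ.- + m)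
  q⊥-m = subst (Coprime q) (sym (∣-i∣≡∣i∣ (+ m))) q⊥m
  q⊥cq-m : ℤ.Coprime (+ q) (c ℤ.* + q - + m)
  q⊥cq-m = subst (ℤ.Coprime (+ q)) (ℤ.+-comm (ℤ.- + m) (c ℤ.* + q))
                 (coprime-+-*ʳ (+ q) (ℤ.- + m) c q⊥-m)

[m-d]q-m≡mq-[qd+m] : ∀ m d q → (+ m - + d) ℤ.* + q - + m ≡ + (m * q) - + (q * d + m)
[m-d]q-m≡mq-[qd+m] m d q = begin
  (+ m - + d) ℤ.* + q - + m           ≡⟨ expand (+ m) (+ d) (+ q) ⟩
  + m ℤ.* + q - (+ q ℤ.* + d ℤ.+ + m) ≡⟨ cong₂ (λ a b → a - (b ℤ.+ + m)) (sym (pos-* m q))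
                                                                          (sym (pos-* q d)) ⟩
  + (m * q) - (+ (q * d) ℤ.+ + m)     ≡⟨ cong (+ (m * q) -_) (sym (pos-+ (q * d) m)) ⟩
  + (m * q) - + (q * d + m)           ∎
  where
  expand : ∀ (m d q : ℤ) → (m - d) ℤ.* q - m ≡ m ℤ.* q - (q ℤ.* d ℤ.+ m)
  expand = solve-∀

-- R ≥ 1 is unused: squarefreeness already excludes R = 0.
mainTheorem7 : (R : ℕ) → R ≥ 1 → SquareFree R →
    gcd (+ R) ((+ R) - (+ ∂ R)) ≡ + 1 →
    (q : ℕ) → Prime q → ¬ (q ∣ R) →
    ((((+ R) - (+ ∂ R)) Data.Integer.* (+ q)) - (+ R) ≡ (+ (R * q)) - (+ ∂ (R * q)))
    × (gcd (+ (R * q)) ((((+ R) - (+ ∂ R)) Data.Integer.* (+ q)) - (+ R)) ≡ + 1)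
mainTheorem7 R _ sf gcd[R,c]≡1 q pq q∤R = cq-R≡Rq-∂[Rq] , cong +_ (coprime⇒gcd≡1 Rq⊥cq-R)
  where
  cq-R≡Rq-∂[Rq] : (+ R - + ∂ R) ℤ.* + q - + R ≡ + (R * q) - + ∂ (R * q)
  cq-R≡Rq-∂[Rq] = begin
    (+ R - + ∂ R) ℤ.* + q - + R  ≡⟨ [m-d]q-m≡mq-[qd+m] R (∂ R) q ⟩
    + (R * q) - + (q * ∂ R + R)  ≡⟨ cong (λ d → + (R * q) - + d) (sym (∂-*-prime sf pq q∤R)) ⟩
    + (R * q) - + ∂ (R * q)      ∎
  Rq⊥cq-R : ℤ.Coprime (+ (R * q)) ((+ R - + ∂ R) ℤ.* + q - + R)
  Rq⊥cq-R = coprime[mq,cq-m] (+ R - + ∂ R) (gcd≡1⇒coprime (+-injective gcd[R,c]≡1)) pq q∤R
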